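{- For every integer $k \ge 3$, there is a deterministic one-way number-on-the-forehead protocol for $\widehat{\textsc{mpj}}^{\rm perm}_k$ of communication cost $O(n \log^{(k-1)}n)$ in which every player is collapsing.
   Context: Logarithms are base $2$ and $\log^{(m)}n$ denotes the $m$-times iterated logarithm of $n$; $[n]=\{1,\dots,n\}$. $\widehat{\textsc{mpj}}_k:[n]\times([n]^{[n]})^{k-1}\to[n]$ is given by $\widehat{\textsc{mpj}}_k(i,f_2,\ldots,f_k) = f_k\circ\cdots\circ f_2(i)$, and $\widehat{\textsc{mpj}}^{\rm perm}_k$ is its restriction to inputs in which $f_2,\dots,f_k$ are all permutations of $[n]$. Write the input as $(z_1,\dots,z_k)$ with $z_1=i$, $z_j=f_j$ for $j\ge2$. In the number-on-the-forehead model $z_j$ is on player $j$'s forehead and she sees all $z_h$, $h\ne j$. In a deterministic one-way protocol, players $1,\dots,k$ each write exactly one message on a public blackboard in this order, each message a deterministic function of what the player sees and earlier messages; player $k$'s message must equal the function value. Cost is the total number of bits written in the worst case. Player $j$ is collapsing if her message depends only on the previous messages, on $z_1,\dots,z_{j-1}$, and on the function $g_j(w_1,\dots,w_j)=\widehat{\textsc{mpj}}_k(w_1,\dots,w_j,z_{j+1},\dots,z_k)$; concretely, only on the previous messages, $i,f_2,\dots,f_{j-1}$ and the composition $f_k\circ\cdots\circ f_{j+1}$ (player $k$ sees only $i,f_2,\dots,f_{k-1}$ and the messages). -}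

module Defs where

open import Data.Nat using (ℕ; zero; suc; _+_; _*_; _∸_; _≤_; _<_)
open import Data.Nat.Logarithm using (⌊log₂_⌋)
open import Data.Fin using (Fin; toℕ)
open import Data.Vec using (Vec; lookup; toList)
open import Data.List using (List; []; _∷_; _++_; [_]; drop; map; length)
open import Data.Nat.ListAction using (sum)
open import Data.Bool using (Bool)
open import Data.Product using (_×_; ∃)
open import Relation.Binary.PropositionalEquality using (_≡_; _≢_)

iterLog : ℕ → ℕ → ℕ
iterLog zero    n = n
iterLog (suc m) n = ⌊log₂ (iterLog m n) ⌋

Table : ℕ → Set
Table n = Vec (Fin n) n

IsPerm : ∀ {n} → Table n → Set
IsPerm {n} f = (∀ a b → lookup f a ≡ lookup f b → a ≡ b)
             × (∀ b → ∃ λ a → lookup f a ≡ b)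

-- input (z_1,…,z_k) = (i, f_2,…,f_k); fs has f_2 at index 0, …, f_k at index k-2
record Input (k n : ℕ) : Set where
  constructor input
  field
    start : Fin n
    fs    : Vec (Table n) (k ∸ 1)
open Input public

Promise : ∀ {k n} → Input k n → Set
Promise x = ∀ h → IsPerm (lookup (fs x) h)

compose : ∀ {n} → List (Table n) → Fin n → Fin n
compose []       a = a
compose (f ∷ gs) a = compose gs (lookup f a)

mpj : ∀ {k n} → Input k n → Fin n
mpj x = compose (toList (fs x)) (start x)

Message : Set
Message = List Bool

Transcript : Set
Transcript = List Message

-- A deterministic one-way protocol: players are 0-based, j = 0,…,k-1
-- (player j here is player j+1 of the paper). msg j x t is the message of
-- player j on input x given blackboard t of earlier messages; out decodes
-- the last player's message to the output value.
record Protocol (k n : ℕ) : Set where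
  field
    msg : ℕ → Input k n → Transcript → Message
    out : Message → Fin n
open Protocol public

board : ∀ {k n} → Protocol k n → ℕ → Input k n → Transcript
board P zero    x = []
board P (suc j) x = board P j x ++ [ msg P j x (board P j x) ]

-- x and y agree on all coordinates except coordinate j (0-based: coordinate 0
-- is i = z_1, coordinate h+1 is fs[h] = z_{h+2})
AgreeExcept : ∀ {k n} → ℕ → Input k n → Input k n → Set
AgreeExcept j x y = (j ≢ 0 → start x ≡ start y)
                  × (∀ h → suc (toℕ h) ≢ j → lookup (fs x) h ≡ lookup (fs y) h)

-- number-on-the-forehead: player j's message is a function of what she sees
-- (all coordinates but her own) and the earlier messages
IsNOF : ∀ {k n} → Protocol k n → Set
IsNOF {k} P = ∀ j → j < k → ∀ x y → Promise x → Promise y →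
  AgreeExcept j x y → ∀ t → msg P j x t ≡ msg P j y t

Correct : ∀ {k n} → Protocol k n → Set
Correct {k} P = ∀ x → Promise x → out P (msg P (k ∸ 1) x (board P (k ∸ 1) x)) ≡ mpj x

-- collapsing: player j's message depends only on earlier messages, on
-- coordinates z_1,…,z_j (0-based: < j), and on the composition of the
-- maps on coordinates > j (0-based), i.e. f_k ∘ … ∘ f_{j+2}.
Collapsing : ∀ {k n} → Protocol k n → ℕ → Set
Collapsing P j = ∀ x y → Promise x → Promise y →
  (0 < j → start x ≡ start y) →
  (∀ h → suc (toℕ h) < j → lookup (fs x) h ≡ lookup (fs y) h) →
  (∀ a → compose (drop j (toList (fs x))) a ≡ compose (drop j (toList (fs y))) a) →
  ∀ t → msg P j x t ≡ msg P j y t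

AllCollapsing : ∀ {k n} → Protocol k n → Set
AllCollapsing {k} P = ∀ j → j < k → Collapsing P j

CostAtMost : ∀ {k n} → Protocol k n → ℕ → Set
CostAtMost {k} P c = ∀ x → Promise x → sum (map length (board P k x)) ≤ c

-- Number the players from 0.  Player 0 sees G₀ = f_k ∘ ⋯ ∘ f_2 and writes, for every a ∈ [n],
-- the top 1 + log^(k-1) n bits of G₀ a.  Player j + 1 sees the pointer p = f_{j+1} ∘ ⋯ ∘ f_2 (i)
-- and G_{j+1} = f_k ∘ ⋯ ∘ f_{j+3}; from the previous message she reads the top 1 + log^(k-1-j) n
-- bits of the answer G_j p = G_{j+1} (f_{j+2} p), and writes the top 1 + log^(k-2-j) n bits of
-- G_{j+1} a only for those a for which G_{j+1} a has the same top bits as the answer.  As G_{j+1}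
-- is a permutation there are at most 2^(⌊log n⌋ - log^(k-1-j) n) such a, so the message has O(n)
-- bits because log^(k-1-j) n = ⌊log (log^(k-2-j) n)⌋.  The last player reads all bits of the
-- answer.  Every player uses only the composition of the maps after her own, so the protocol is
-- collapsing, and collapsing protocols are number-on-the-forehead protocols.

module Submission where

open import Defs
open import Data.Bool using (Bool; true; false; if_then_else_)
open import Data.Fin using (Fin; zero; suc; toℕ; fromℕ<)
open import Data.Fin.Properties using (toℕ-injective; toℕ-fromℕ<; toℕ<n; injective⇒≤) renaming (_≟_ to _≟ᶠ_)
open import Data.List as List using (List; []; _∷_; _++_; [_]; _∷ʳ_; take; drop; filter; length; map; last; allFin)
open import Data.List.Properties using (length-++; length-take; take++drop≡id; length-filter; length-tabulate; map-++)
open import Data.List.Membership.Propositional using (_∈_)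
open import Data.List.Membership.Propositional.Properties using (∈-lookup; ∈-filter⁻; ∈-allFin)
open import Data.List.Relation.Unary.All as All using (All; []; _∷_)
open import Data.List.Relation.Unary.All.Properties using (drop⁺)
import Data.List.Relation.Unary.Any as Any
open import Data.List.Relation.Unary.Unique.Propositional using (Unique; _∷_)
import Data.List.Relation.Unary.Unique.Propositional.Properties as Unique
open import Data.Maybe using (just; fromMaybe)
open import Data.Nat
open import Data.Nat.DivMod
open import Data.Nat.Induction using (<-wellFounded)
open import Data.Nat.ListAction using (sum)
open import Data.Nat.ListAction.Properties using (sum-++)
open import Data.Nat.Logarithm
open import Data.Nat.Logarithm.Core using (⌊log2⌋)
open import Data.Nat.Properties
open import Data.Nat.Tactic.RingSolver using (solve-∀)
open import Data.Product using (Σ; ∃; _×_; _,_; proj₁; proj₂)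
open import Data.Unit using (tt)
open import Data.Vec using (Vec; lookup; tabulate; toList) renaming ([] to []ᵛ; _∷_ to _∷ᵛ_)
open import Data.Vec.Properties using (lookup∘tabulate; tabulate-cong; tabulate∘lookup)
open import Function using (_∘_; id; Injective)
open import Induction.WellFounded using (Acc; acc)
open import Level using (0ℓ)
open import Relation.Binary using (DecidableEquality)
open import Relation.Binary.PropositionalEquality hiding ([_])
open import Relation.Nullary using (Dec; does; yes; no; contradiction)
open import Relation.Nullary.Decidable using (dec-true; dec-false)
open import Relation.Unary using (Pred; Decidable)
open import Relation.Unary.Properties using (U?)

2*⌊n/2⌋≤n : ∀ n → 2 * ⌊ n /2⌋ ≤ n
2*⌊n/2⌋≤n n = begin
  2 * ⌊ n /2⌋        ≡⟨ cong (⌊ n /2⌋ +_) (+-identityʳ ⌊ n /2⌋) ⟩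
  ⌊ n /2⌋ + ⌊ n /2⌋  ≤⟨ +-monoʳ-≤ ⌊ n /2⌋ (⌊n/2⌋≤⌈n/2⌉ n) ⟩
  ⌊ n /2⌋ + ⌈ n /2⌉  ≡⟨ ⌊n/2⌋+⌈n/2⌉≡n n ⟩
  n                  ∎
  where open ≤-Reasoning

-- The next two lemmas recurse on the accessibility proof, as ⌊log₂_⌋ itself does, so that
-- ⌊log2⌋ (2 + m) unfolds to 1 + ⌊log2⌋ (1 + ⌊ m /2⌋).
⌊log₂n⌋≤n : ∀ n → ⌊log₂ n ⌋ ≤ n
⌊log₂n⌋≤n n = go n (<-wellFounded n)
  where
  go : ∀ n (rec : Acc _<_ n) → ⌊log2⌋ n rec ≤ n
  go 0 _ = z≤n
  go 1 _ = z≤n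
  go (suc (suc m)) (acc rs) = s≤s (≤-trans (go (suc ⌊ m /2⌋) _) (s≤s (⌊n/2⌋≤n m)))

2^⌊log₂n⌋≤n : ∀ n .{{_ : NonZero n}} → 2 ^ ⌊log₂ n ⌋ ≤ n
2^⌊log₂n⌋≤n n = go n (<-wellFounded n)
  where
  go : ∀ n .{{_ : NonZero n}} (rec : Acc _<_ n) → 2 ^ ⌊log2⌋ n rec ≤ n
  go 1 _ = ≤-refl
  go (suc (suc m)) (acc rs) = ≤-trans (*-monoʳ-≤ 2 (go (suc ⌊ m /2⌋) _)) (2*⌊n/2⌋≤n (2 + m))

n<2^[1+⌊log₂n⌋] : ∀ n → n < 2 ^ suc ⌊log₂ n ⌋
n<2^[1+⌊log₂n⌋] n with n <? 2 ^ suc ⌊log₂ n ⌋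
... | yes n<2^ = n<2^
... | no n≮2^ = contradiction
  (subst (_≤ ⌊log₂ n ⌋) (⌊log₂[2^n]⌋≡n _) (⌊log₂⌋-mono-≤ (≮⇒≥ n≮2^))) 1+n≰n

[1+m]*2^[⌊log₂n⌋∸⌊log₂m⌋]≤2*n : ∀ {m n} .{{_ : NonZero n}} → m ≤ n →
  suc m * 2 ^ (⌊log₂ n ⌋ ∸ ⌊log₂ m ⌋) ≤ 2 * n
[1+m]*2^[⌊log₂n⌋∸⌊log₂m⌋]≤2*n {m} {n} m≤n = begin
  suc m * 2 ^ (⌊log₂ n ⌋ ∸ ⌊log₂ m ⌋)
    ≤⟨ *-monoˡ-≤ _ (n<2^[1+⌊log₂n⌋] m) ⟩
  2 ^ suc ⌊log₂ m ⌋ * 2 ^ (⌊log₂ n ⌋ ∸ ⌊log₂ m ⌋)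
    ≡⟨ ^-distribˡ-+-* 2 (suc ⌊log₂ m ⌋) _ ⟨
  2 * 2 ^ (⌊log₂ m ⌋ + (⌊log₂ n ⌋ ∸ ⌊log₂ m ⌋))
    ≡⟨ cong (λ e → 2 * 2 ^ e) (m+[n∸m]≡n (⌊log₂⌋-mono-≤ m≤n)) ⟩
  2 * 2 ^ ⌊log₂ n ⌋
    ≤⟨ *-monoʳ-≤ 2 (2^⌊log₂n⌋≤n n) ⟩
  2 * n ∎
  where open ≤-Reasoning

iterLog≤ : ∀ t n → iterLog t n ≤ n
iterLog≤ zero    n = ≤-refl
iterLog≤ (suc t) n = ≤-trans (⌊log₂n⌋≤n _) (iterLog≤ t n)

iterLog-mono-≤ : ∀ t {m n} → m ≤ n → iterLog t m ≤ iterLog t n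
iterLog-mono-≤ zero    m≤n = m≤n
iterLog-mono-≤ (suc t) m≤n = ⌊log₂⌋-mono-≤ (iterLog-mono-≤ t m≤n)

iterLog-suc : ∀ t n → iterLog (suc t) n ≡ iterLog t ⌊log₂ n ⌋
iterLog-suc zero    n = refl
iterLog-suc (suc t) n = cong ⌊log₂_⌋ (iterLog-suc t n)

tower : ℕ → ℕ
tower zero    = 1
tower (suc t) = 2 ^ tower t

iterLog[tower]≡1 : ∀ t → iterLog t (tower t) ≡ 1
iterLog[tower]≡1 zero    = refl
iterLog[tower]≡1 (suc t) = begin
  iterLog (suc t) (2 ^ tower t)   ≡⟨ iterLog-suc t _ ⟩
  iterLog t ⌊log₂ 2 ^ tower t ⌋   ≡⟨ cong (iterLog t) (⌊log₂[2^n]⌋≡n (tower t)) ⟩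
  iterLog t (tower t)             ≡⟨ iterLog[tower]≡1 t ⟩
  1                               ∎
  where open ≡-Reasoning

_/2^_ : ℕ → ℕ → ℕ
v /2^ r = _/_ v (2 ^ r) {{m^n≢0 2 r}}

toBits : ℕ → ℕ → List Bool
toBits zero    v = []
toBits (suc w) v = (v % 2 ≡ᵇ 1) ∷ toBits w (v / 2)

fromBits : List Bool → ℕ
fromBits []       = 0
fromBits (b ∷ bs) = (if b then 1 else 0) + 2 * fromBits bs

length-toBits : ∀ w v → length (toBits w v) ≡ w
length-toBits zero    v = refl
length-toBits (suc w) v = cong suc (length-toBits w (v / 2))

fromBits-toBits : ∀ w {v} → v < 2 ^ w → fromBits (toBits w v) ≡ v
fromBits-toBits zero    {zero} _ = refl
fromBits-toBits zero    {suc v} (s≤s ())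
fromBits-toBits (suc w) {v} v<2^[1+w] = begin
  (if v % 2 ≡ᵇ 1 then 1 else 0) + 2 * fromBits (toBits w (v / 2))
    ≡⟨ cong₂ (λ b h → b + 2 * h) lowBit (fromBits-toBits w (m<n*o⇒m/o<n v<2^w*2)) ⟩
  v % 2 + 2 * (v / 2)  ≡⟨ cong (v % 2 +_) (*-comm 2 (v / 2)) ⟩
  v % 2 + v / 2 * 2    ≡⟨ m≡m%n+[m/n]*n v 2 ⟨
  v                    ∎
  where
  open ≡-Reasoning
  v<2^w*2 : v < 2 ^ w * 2
  v<2^w*2 = subst (v <_) (*-comm 2 (2 ^ w)) v<2^[1+w]
  lowBit : (if v % 2 ≡ᵇ 1 then 1 else 0) ≡ v % 2
  lowBit with v % 2 | m%n<n v 2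
  ... | 0 | _ = refl
  ... | 1 | _ = refl
  ... | suc (suc _) | s≤s (s≤s ())

private variable
  A : Set

take-length-++ : ∀ (xs ys : List A) → take (length xs) (xs ++ ys) ≡ xs
take-length-++ []       ys = refl
take-length-++ (x ∷ xs) ys = cong (x ∷_) (take-length-++ xs ys)

drop-length-++ : ∀ (xs ys : List A) → drop (length xs) (xs ++ ys) ≡ ys
drop-length-++ []       ys = refl
drop-length-++ (x ∷ xs) ys = drop-length-++ xs ys

last-∷ʳ : ∀ (xs : List A) x → last (xs ∷ʳ x) ≡ just x
last-∷ʳ []           x = refl
last-∷ʳ (_ ∷ [])     x = refl
last-∷ʳ (_ ∷ y ∷ xs) x = last-∷ʳ (y ∷ xs) x

module _ {P : Pred A 0ℓ} (P? : Decidable P) where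

  encodeMarked : (A → List Bool) → List A → List Bool
  encodeMarked e []       = []
  encodeMarked e (y ∷ ys) =
    if does (P? y) then true ∷ e y ++ encodeMarked e ys else false ∷ encodeMarked e ys

  length-encodeMarked : ∀ {w} (e : A → List Bool) → (∀ y → length (e y) ≡ w) → ∀ ys →
    length (encodeMarked e ys) ≡ length ys + w * length (filter P? ys)
  length-encodeMarked {w} e ∣e∣≡w [] = sym (*-zeroʳ w)
  length-encodeMarked {w} e ∣e∣≡w (y ∷ ys) with does (P? y)
  ... | false = cong suc (length-encodeMarked e ∣e∣≡w ys)
  ... | true  = cong suc (begin
    length (e y ++ encodeMarked e ys)          ≡⟨ length-++ (e y) ⟩
    length (e y) + length (encodeMarked e ys)  ≡⟨ cong₂ _+_ (∣e∣≡w y) (length-encodeMarked e ∣e∣≡w ys) ⟩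
    w + (length ys + w * c)                    ≡⟨ regroup w (length ys) c ⟩
    length ys + w * suc c                      ∎)
    where
    open ≡-Reasoning
    c = length (filter P? ys)
    regroup : ∀ w l c → w + (l + w * c) ≡ l + w * suc c
    regroup = solve-∀

module _ (_≟_ : DecidableEquality A) (w : ℕ) (t : A) where

  decodeAt : List A → List Bool → List Bool
  decodeAt []       _            = []
  decodeAt (_ ∷ _)  []           = []
  decodeAt (_ ∷ ys) (false ∷ bs) = decodeAt ys bs
  decodeAt (y ∷ ys) (true ∷ bs)  = if does (y ≟ t) then take w bs else decodeAt ys (drop w bs)

  length-decodeAt≤ : ∀ ys bs → length (decodeAt ys bs) ≤ w
  length-decodeAt≤ []       _            = z≤n
  length-decodeAt≤ (_ ∷ _)  []           = z≤n
  length-decodeAt≤ (_ ∷ ys) (false ∷ bs) = length-decodeAt≤ ys bs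
  length-decodeAt≤ (y ∷ ys) (true ∷ bs) with does (y ≟ t)
  ... | true  = ≤-trans (≤-reflexive (length-take w bs)) (m⊓n≤m w (length bs))
  ... | false = length-decodeAt≤ ys (drop w bs)

  decodeAt-encodeMarked : ∀ {P : Pred A 0ℓ} (P? : Decidable P) (e : A → List Bool) →
    (∀ y → length (e y) ≡ w) → P t → ∀ {ys} → t ∈ ys → decodeAt ys (encodeMarked P? e ys) ≡ e t
  decodeAt-encodeMarked P? e ∣e∣≡w Pt {y ∷ ys} t∈ with P? y
  ... | no ¬Py with y ≟ t
  ...   | yes refl = contradiction Pt ¬Py
  ...   | no y≢t   = decodeAt-encodeMarked P? e ∣e∣≡w Pt (Any.tail (y≢t ∘ sym) t∈)
  decodeAt-encodeMarked P? e ∣e∣≡w Pt {y ∷ ys} t∈ | yes _ with y ≟ t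
  ...   | yes refl = subst (λ w → take w (e y ++ _) ≡ e y) (∣e∣≡w y) (take-length-++ (e y) _)
  ...   | no y≢t   = begin
    decodeAt ys (drop w (e y ++ encodeMarked P? e ys))
      ≡⟨ cong (decodeAt ys) (subst (λ w → drop w (e y ++ _) ≡ _) (∣e∣≡w y) (drop-length-++ (e y) _)) ⟩
    decodeAt ys (encodeMarked P? e ys)
      ≡⟨ decodeAt-encodeMarked P? e ∣e∣≡w Pt (Any.tail (y≢t ∘ sym) t∈) ⟩
    e t ∎
    where open ≡-Reasoning

Unique⇒lookup-injective : ∀ {xs : List A} → Unique xs → Injective _≡_ _≡_ (List.lookup xs)
Unique⇒lookup-injective (_ ∷ _)     {zero}  {zero}  _  = refl
Unique⇒lookup-injective (x≢ ∷ _)    {zero}  {suc j} eq = contradiction eq (All.lookup x≢ (∈-lookup j))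
Unique⇒lookup-injective (x≢ ∷ _)    {suc i} {zero}  eq = contradiction (sym eq) (All.lookup x≢ (∈-lookup i))
Unique⇒lookup-injective (_ ∷ uniq)  {suc i} {suc j} eq = cong suc (Unique⇒lookup-injective uniq eq)

length-unique≤ : ∀ {m} {xs : List A} → Unique xs → (h : A → Fin m) →
  (∀ {a b} → a ∈ xs → b ∈ xs → h a ≡ h b → a ≡ b) → length xs ≤ m
length-unique≤ {xs = xs} uniq h inj = injective⇒≤ λ {i} {j} hᵢ≡hⱼ →
  Unique⇒lookup-injective uniq (inj (∈-lookup i) (∈-lookup j) hᵢ≡hⱼ)

length-filter[/2^r≡c]≤2^r : ∀ {xs : List A} → Unique xs → (g : A → ℕ) → Injective _≡_ _≡_ g →
  ∀ r c → length (filter (λ x → g x /2^ r ≟ c) xs) ≤ 2 ^ r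
length-filter[/2^r≡c]≤2^r {xs = xs} uniq g g-inj r c =
  length-unique≤ (Unique.filter⁺ inBlock? uniq) remainder remainder-inj
  where
  instance
    2^r≢0 : NonZero (2 ^ r)
    2^r≢0 = m^n≢0 2 r
  inBlock? : ∀ x → Dec (g x / 2 ^ r ≡ c)
  inBlock? x = g x / 2 ^ r ≟ c
  remainder : _ → Fin (2 ^ r)
  remainder x = fromℕ< (m%n<n (g x) (2 ^ r))
  remainder-inj : ∀ {a b} → a ∈ filter inBlock? xs → b ∈ filter inBlock? xs → remainder a ≡ remainder b → a ≡ b
  remainder-inj {a} {b} a∈ b∈ ra≡rb = g-inj (begin
    g a                                ≡⟨ m≡m%n+[m/n]*n (g a) (2 ^ r) ⟩
    g a % 2 ^ r + g a / 2 ^ r * 2 ^ r  ≡⟨ cong₂ (λ u v → u + v * 2 ^ r) %-eq /-eq ⟩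
    g b % 2 ^ r + g b / 2 ^ r * 2 ^ r  ≡⟨ m≡m%n+[m/n]*n (g b) (2 ^ r) ⟨
    g b                                ∎)
    where
    open ≡-Reasoning
    %-eq : g a % 2 ^ r ≡ g b % 2 ^ r
    %-eq = trans (sym (toℕ-fromℕ< _)) (trans (cong toℕ ra≡rb) (toℕ-fromℕ< _))
    /-eq : g a / 2 ^ r ≡ g b / 2 ^ r
    /-eq = trans (proj₂ (∈-filter⁻ inBlock? {xs = xs} a∈)) (sym (proj₂ (∈-filter⁻ inBlock? {xs = xs} b∈)))

compose-++ : ∀ {n} (fs gs : List (Table n)) a → compose (fs ++ gs) a ≡ compose gs (compose fs a)
compose-++ []       gs a = refl
compose-++ (f ∷ fs) gs a = compose-++ fs gs (lookup f a)

compose-take-drop : ∀ {n} j (fs : List (Table n)) a →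
  compose (drop j fs) (compose (take j fs) a) ≡ compose fs a
compose-take-drop j fs a =
  trans (sym (compose-++ (take j fs) (drop j fs) a)) (cong (λ gs → compose gs a) (take++drop≡id j fs))

TableInjective : ∀ {n} → Table n → Set
TableInjective f = ∀ a b → lookup f a ≡ lookup f b → a ≡ b

compose-injective : ∀ {n} {fs : List (Table n)} → All TableInjective fs → Injective _≡_ _≡_ (compose fs)
compose-injective []             eq = eq
compose-injective (f-inj ∷ inj) {a} {b} eq = f-inj a b (compose-injective inj eq)

All-toList : ∀ {m} {P : Pred A 0ℓ} (v : Vec A m) → (∀ h → P (lookup v h)) → All P (toList v)
All-toList []ᵛ       _  = []
All-toList (x ∷ᵛ v) Pv = Pv zero ∷ All-toList v (Pv ∘ suc)

take-toList-cong : ∀ {m} r (u v : Vec A m) → (∀ h → toℕ h < r → lookup u h ≡ lookup v h) →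
  take r (toList u) ≡ take r (toList v)
take-toList-cong zero    u         v         _  = refl
take-toList-cong (suc r) []ᵛ       []ᵛ       _  = refl
take-toList-cong (suc r) (x ∷ᵛ u) (y ∷ᵛ v) eq =
  cong₂ _∷_ (eq zero z<s) (take-toList-cong r u v (λ h h<r → eq (suc h) (s≤s h<r)))

drop-toList-cong : ∀ {m} r (u v : Vec A m) → (∀ h → r ≤ toℕ h → lookup u h ≡ lookup v h) →
  drop r (toList u) ≡ drop r (toList v)
drop-toList-cong zero    u         v         eq = cong toList (begin
  u                  ≡⟨ tabulate∘lookup u ⟨
  tabulate (lookup u) ≡⟨ tabulate-cong (λ h → eq h z≤n) ⟩
  tabulate (lookup v) ≡⟨ tabulate∘lookup v ⟩
  v                  ∎)
  where open ≡-Reasoning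
drop-toList-cong (suc r) []ᵛ       []ᵛ       _  = refl
drop-toList-cong (suc r) (_ ∷ᵛ u) (_ ∷ᵛ v) eq = drop-toList-cong r u v (λ h r≤h → eq (suc h) (s≤s r≤h))

AllCollapsing⇒IsNOF : ∀ {k n} (P : Protocol k n) → AllCollapsing P → IsNOF P
AllCollapsing⇒IsNOF P collapsing j j<k x y px py (start≡ , fs≡) =
  collapsing j j<k x y px py
    (λ 0<j → start≡ (λ j≡0 → <-irrefl (sym j≡0) 0<j))
    (λ h 1+h<j → fs≡ h (λ 1+h≡j → <-irrefl 1+h≡j 1+h<j))
    (λ a → cong (λ gs → compose gs a)
      (drop-toList-cong j (fs x) (fs y) (λ h j≤h → fs≡ h (λ 1+h≡j → <-irrefl (sym 1+h≡j) (s≤s j≤h)))))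

sum-length-board≤ : ∀ {k n} (P : Protocol k n) x {B} →
  (∀ j → j < k → length (msg P j x (board P j x)) ≤ B) →
  ∀ j → j ≤ k → sum (map length (board P j x)) ≤ j * B
sum-length-board≤ P x ∣msg∣≤B zero    _      = z≤n
sum-length-board≤ P x {B} ∣msg∣≤B (suc j) 1+j≤k = begin
  sum (map length (board P j x ∷ʳ mj))               ≡⟨ cong sum (map-++ length (board P j x) [ mj ]) ⟩
  sum (map length (board P j x) ++ [ length mj ])    ≡⟨ sum-++ (map length (board P j x)) [ length mj ] ⟩
  sum (map length (board P j x)) + (length mj + 0)   ≤⟨ +-mono-≤ (sum-length-board≤ P x ∣msg∣≤B j (<⇒≤ 1+j≤k))
                                                                  (+-monoˡ-≤ 0 (∣msg∣≤B j 1+j≤k)) ⟩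
  j * B + (B + 0)                                    ≡⟨ cong (j * B +_) (+-identityʳ B) ⟩
  j * B + B                                          ≡⟨ +-comm (j * B) B ⟩
  suc j * B                                          ∎
  where
  open ≤-Reasoning
  mj = msg P j x (board P j x)

k[2n+[1+A]n]≤4knA : ∀ k n A → 1 ≤ A → k * (2 * n + suc A * n) ≤ 4 * k * n * A
k[2n+[1+A]n]≤4knA k n A 1≤A = begin
  k * (2 * n + suc A * n)    ≡⟨ regroup k n A ⟩
  k * (3 * n + A * n)        ≤⟨ *-monoʳ-≤ k (+-monoˡ-≤ (A * n) (*-monoʳ-≤ 3 (m≤n*m n A {{>-nonZero 1≤A}}))) ⟩
  k * (3 * (A * n) + A * n)  ≡⟨ collect k n A ⟩
  4 * k * n * A              ∎
  where
  open ≤-Reasoning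
  regroup : ∀ k n A → k * (2 * n + suc A * n) ≡ k * (3 * n + A * n)
  regroup = solve-∀
  collect : ∀ k n A → k * (3 * (A * n) + A * n) ≡ 4 * k * n * A
  collect = solve-∀

module PointerChasing (m n : ℕ) .{{_ : NonZero n}} where

  ℓ : ℕ → ℕ
  ℓ j = iterLog (suc m ∸ j) n

  width shift : ℕ → ℕ
  width j = suc (ℓ j)
  shift j = ⌊log₂ n ⌋ ∸ ℓ j

  high : ℕ → Fin n → ℕ
  high j v = toℕ v /2^ shift j

  label : ℕ → Fin n → Message
  label j v = toBits (width j) (high j v)

  readEntry : ℕ → Fin n → Transcript → Message
  readEntry i p t = decodeAt _≟ᶠ_ (width i) p (allFin n) (fromMaybe [] (last t))

  announceAll : Table n → Message
  announceAll G = encodeMarked U? (label 0 ∘ lookup G) (allFin n)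

  announceBlock : ℕ → ℕ → Table n → Message
  announceBlock i c G = encodeMarked (λ y → high i (lookup G y) ≟ c) (label (suc i) ∘ lookup G) (allFin n)

  reply : ℕ → Fin n → Table n → Transcript → Message
  reply i p G t =
    if does (i ≟ m) then readEntry i p t else announceBlock i (fromBits (readEntry i p t)) G

  pointer : ℕ → Input (2 + m) n → Fin n
  pointer i x = compose (take i (toList (fs x))) (start x)

  -- Tabulated, so that the pointwise equality provided by Collapsing becomes an equality of messages.
  suffix : ℕ → Input (2 + m) n → Table n
  suffix j x = tabulate (compose (drop j (toList (fs x))))

  message : ℕ → Input (2 + m) n → Transcript → Message
  message zero    x _ = announceAll (suffix 0 x)
  message (suc i) x t = reply i (pointer i x) (suffix (suc i) x) t

  protocol : Protocol (2 + m) n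
  protocol = record { msg = message ; out = λ bs → fromBits bs mod n }

  high<2^width : ∀ j v → high j v < 2 ^ width j
  high<2^width j v = m<n*o⇒m/o<n {{m^n≢0 2 (shift j)}} (begin-strict
    toℕ v                           <⟨ toℕ<n v ⟩
    n                               <⟨ n<2^[1+⌊log₂n⌋] n ⟩
    2 ^ suc ⌊log₂ n ⌋               ≤⟨ ^-monoʳ-≤ 2 (s≤s (m≤n+m∸n ⌊log₂ n ⌋ (ℓ j))) ⟩
    2 ^ (width j + shift j)         ≡⟨ ^-distribˡ-+-* 2 (width j) (shift j) ⟩
    2 ^ width j * 2 ^ shift j       ∎)
    where open ≤-Reasoning

  fromBits-label : ∀ j v → fromBits (label j v) ≡ high j v
  fromBits-label j v = fromBits-toBits (width j) (high<2^width j v)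

  length-label : ∀ j v → length (label j v) ≡ width j
  length-label j v = length-toBits (width j) (high j v)

  readEntry-∷ʳ : ∀ i p t bs → readEntry i p (t ∷ʳ bs) ≡ decodeAt _≟ᶠ_ (width i) p (allFin n) bs
  readEntry-∷ʳ i p t bs = cong (decodeAt _≟ᶠ_ (width i) p (allFin n) ∘ fromMaybe []) (last-∷ʳ t bs)

  lookup-suffix-pointer : ∀ j x → lookup (suffix j x) (pointer j x) ≡ mpj x
  lookup-suffix-pointer j x = trans (lookup∘tabulate _ (pointer j x)) (compose-take-drop j (toList (fs x)) (start x))

  reply-last : ∀ p G t → reply m p G t ≡ readEntry m p t
  reply-last p G t rewrite dec-true (m ≟ m) refl = refl

  reply-middle : ∀ {i} → i ≢ m → ∀ p G t → reply i p G t ≡ announceBlock i (fromBits (readEntry i p t)) G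
  reply-middle {i} i≢m p G t rewrite dec-false (i ≟ m) i≢m = refl

  readEntry-correct : ∀ x i → i ≤ m → readEntry i (pointer i x) (board protocol (suc i) x) ≡ label i (mpj x)
  readEntry-correct x zero _ = begin
    readEntry 0 (start x) ([] ∷ʳ announceAll G)                 ≡⟨ readEntry-∷ʳ 0 (start x) [] _ ⟩
    decodeAt _≟ᶠ_ (width 0) (start x) (allFin n) (announceAll G)
      ≡⟨ decodeAt-encodeMarked _≟ᶠ_ (width 0) (start x) U? _ (length-label 0 ∘ lookup G) tt (∈-allFin _) ⟩
    label 0 (lookup G (start x))                                ≡⟨ cong (label 0) (lookup-suffix-pointer 0 x) ⟩
    label 0 (mpj x)                                             ∎
    where
    open ≡-Reasoning
    G = suffix 0 x
  readEntry-correct x (suc i) 1+i≤m = begin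
    readEntry (suc i) p (t ∷ʳ reply i (pointer i x) G t)       ≡⟨ readEntry-∷ʳ (suc i) p t _ ⟩
    decodeAt _≟ᶠ_ (width (suc i)) p (allFin n) (reply i (pointer i x) G t)
      ≡⟨ cong (decodeAt _≟ᶠ_ (width (suc i)) p (allFin n)) reply-announces ⟩
    decodeAt _≟ᶠ_ (width (suc i)) p (allFin n) (announceBlock i (high i (lookup G p)) G)
      ≡⟨ decodeAt-encodeMarked _≟ᶠ_ (width (suc i)) p _ _ (length-label (suc i) ∘ lookup G) refl (∈-allFin p) ⟩
    label (suc i) (lookup G p)                                  ≡⟨ cong (label (suc i)) (lookup-suffix-pointer (suc i) x) ⟩
    label (suc i) (mpj x)                                       ∎
    where
    open ≡-Reasoning
    p = pointer (suc i) x
    t = board protocol (suc i) x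
    G = suffix (suc i) x
    learnt : fromBits (readEntry i (pointer i x) t) ≡ high i (lookup G p)
    learnt = begin
      fromBits (readEntry i (pointer i x) t)   ≡⟨ cong fromBits (readEntry-correct x i (<⇒≤ 1+i≤m)) ⟩
      fromBits (label i (mpj x))               ≡⟨ fromBits-label i (mpj x) ⟩
      high i (mpj x)                           ≡⟨ cong (high i) (lookup-suffix-pointer (suc i) x) ⟨
      high i (lookup G p)                      ∎
    reply-announces : reply i (pointer i x) G t ≡ announceBlock i (high i (lookup G p)) G
    reply-announces = trans (reply-middle (<⇒≢ 1+i≤m) _ G t) (cong (λ c → announceBlock i c G) learnt)

  high-last : ∀ v → high m v ≡ toℕ v
  high-last v = begin
    toℕ v /2^ (⌊log₂ n ⌋ ∸ iterLog (suc m ∸ m) n)  ≡⟨ cong (λ e → toℕ v /2^ (⌊log₂ n ⌋ ∸ iterLog e n)) (m+n∸n≡m 1 m) ⟩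
    toℕ v /2^ (⌊log₂ n ⌋ ∸ ⌊log₂ n ⌋)             ≡⟨ cong (toℕ v /2^_) (n∸n≡0 ⌊log₂ n ⌋) ⟩
    toℕ v / 1                                     ≡⟨ n/1≡n (toℕ v) ⟩
    toℕ v                                         ∎
    where open ≡-Reasoning

  correct : Correct protocol
  correct x _ = toℕ-injective (begin
    toℕ (fromBits (reply m (pointer m x) (suffix (suc m) x) t) mod n)
      ≡⟨ cong (λ bs → toℕ (fromBits bs mod n)) reply-reads ⟩
    toℕ (fromBits (label m (mpj x)) mod n)      ≡⟨ toℕ-fromℕ< _ ⟩
    fromBits (label m (mpj x)) % n              ≡⟨ cong (_% n) (trans (fromBits-label m (mpj x)) (high-last (mpj x))) ⟩
    toℕ (mpj x) % n                             ≡⟨ m<n⇒m%n≡m (toℕ<n (mpj x)) ⟩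
    toℕ (mpj x)                                 ∎)
    where
    open ≡-Reasoning
    t = board protocol (suc m) x
    reply-reads : reply m (pointer m x) (suffix (suc m) x) t ≡ label m (mpj x)
    reply-reads = trans (reply-last (pointer m x) (suffix (suc m) x) t) (readEntry-correct x m ≤-refl)

  collapsing : AllCollapsing protocol
  collapsing zero    _ x y _ _ _      _   suffix≗ _ = cong announceAll (tabulate-cong suffix≗)
  collapsing (suc i) _ x y _ _ start≡ fs≡ suffix≗ t =
    cong₂ (λ p G → reply i p G t) pointer≡ (tabulate-cong suffix≗)
    where
    pointer≡ : pointer i x ≡ pointer i y
    pointer≡ = cong₂ compose (take-toList-cong i (fs x) (fs y) (λ h h<i → fs≡ h (s≤s h<i))) (start≡ z<s)

  suffix-injective : ∀ j x → Promise x → Injective _≡_ _≡_ (lookup (suffix j x))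
  suffix-injective j x px {a} {b} eq =
    compose-injective (drop⁺ j (All-toList (fs x) (proj₁ ∘ px)))
      (trans (sym (lookup∘tabulate _ a)) (trans eq (lookup∘tabulate _ b)))

  length-announceAll≤ : ∀ G → length (announceAll G) ≤ n + width 0 * n
  length-announceAll≤ G = begin
    length (announceAll G)
      ≡⟨ length-encodeMarked U? (label 0 ∘ lookup G) (length-label 0 ∘ lookup G) (allFin n) ⟩
    length (allFin n) + width 0 * length (filter U? (allFin n))
      ≤⟨ +-monoʳ-≤ (length (allFin n)) (*-monoʳ-≤ (width 0) (length-filter U? (allFin n))) ⟩
    length (allFin n) + width 0 * length (allFin n)
      ≡⟨ cong (λ l → l + width 0 * l) (length-tabulate {n = n} id) ⟩
    n + width 0 * n ∎
    where open ≤-Reasoning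

  length-announceBlock≤ : ∀ x → Promise x → ∀ i → i < m → ∀ c →
    length (announceBlock i c (suffix (suc i) x)) ≤ n + 2 * n
  length-announceBlock≤ x px i i<m c = begin
    length (announceBlock i c G)
      ≡⟨ length-encodeMarked inBlock? (label (suc i) ∘ lookup G) (length-label (suc i) ∘ lookup G) (allFin n) ⟩
    length (allFin n) + width (suc i) * length (filter inBlock? (allFin n))
      ≤⟨ +-monoʳ-≤ (length (allFin n)) (*-monoʳ-≤ (width (suc i)) blockSize≤) ⟩
    length (allFin n) + suc (ℓ (suc i)) * 2 ^ (⌊log₂ n ⌋ ∸ ℓ i)
      ≡⟨ cong₂ (λ l e → l + suc (ℓ (suc i)) * 2 ^ (⌊log₂ n ⌋ ∸ e)) (length-tabulate {n = n} id) ℓ-suc ⟩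
    n + suc (ℓ (suc i)) * 2 ^ (⌊log₂ n ⌋ ∸ ⌊log₂ ℓ (suc i) ⌋)
      ≤⟨ +-monoʳ-≤ n ([1+m]*2^[⌊log₂n⌋∸⌊log₂m⌋]≤2*n (iterLog≤ (m ∸ i) n)) ⟩
    n + 2 * n ∎
    where
    open ≤-Reasoning
    G = suffix (suc i) x
    inBlock? = λ y → high i (lookup G y) ≟ c
    blockSize≤ : length (filter inBlock? (allFin n)) ≤ 2 ^ shift i
    blockSize≤ = length-filter[/2^r≡c]≤2^r (Unique.allFin⁺ n) (toℕ ∘ lookup G)
      (suffix-injective (suc i) x px ∘ toℕ-injective) (shift i) c
    ℓ-suc : ℓ i ≡ ⌊log₂ ℓ (suc i) ⌋
    ℓ-suc = cong (λ e → iterLog e n) (+-∸-assoc 1 (<⇒≤ i<m))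

  length-message≤ : ∀ x → Promise x → ∀ j → j < 2 + m →
    length (message j x (board protocol j x)) ≤ 2 * n + width 0 * n
  length-message≤ x px zero _ = ≤-trans (length-announceAll≤ (suffix 0 x)) (+-monoˡ-≤ _ (m≤m+n n (n + 0)))
  length-message≤ x px (suc i) (s≤s 1+i≤1+m) with i ≟ m
  ... | yes refl = begin
    length (reply m (pointer m x) (suffix (suc m) x) t) ≡⟨ cong length (reply-last (pointer m x) (suffix (suc m) x) t) ⟩
    length (readEntry m (pointer m x) t)   ≤⟨ length-decodeAt≤ _≟ᶠ_ (width m) _ (allFin n) _ ⟩
    suc (ℓ m)                             ≤⟨ s≤s (iterLog≤ (suc m ∸ m) n) ⟩
    suc n                                 ≤⟨ +-monoˡ-≤ n (>-nonZero⁻¹ n) ⟩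
    n + n                                 ≤⟨ +-monoʳ-≤ n (m≤m+n n _) ⟩
    2 * n                                 ≤⟨ m≤m+n (2 * n) _ ⟩
    2 * n + width 0 * n                   ∎
    where
    open ≤-Reasoning
    t = board protocol (suc m) x
  ... | no i≢m = begin
    length (reply i (pointer i x) (suffix (suc i) x) t) ≡⟨ cong length (reply-middle i≢m (pointer i x) (suffix (suc i) x) t) ⟩
    length (announceBlock i _ (suffix (suc i) x))
      ≤⟨ length-announceBlock≤ x px i (≤∧≢⇒< (s≤s⁻¹ 1+i≤1+m) i≢m) _ ⟩
    n + 2 * n                             ≡⟨ +-comm n (2 * n) ⟩
    2 * n + n                             ≤⟨ +-monoʳ-≤ (2 * n) (m≤m+n n _) ⟩
    2 * n + width 0 * n                   ∎
    where
    open ≤-Reasoning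
    t = board protocol (suc i) x

  cost : CostAtMost protocol ((2 + m) * (2 * n + width 0 * n))
  cost x px = sum-length-board≤ protocol x (length-message≤ x px) (2 + m) ≤-refl

pointerChasing : ∀ m n → tower (suc m) ≤ n →
  Σ (Protocol (2 + m) n) λ P → IsNOF P × Correct P × AllCollapsing P
    × CostAtMost P (4 * (2 + m) * n * iterLog (suc m) n)
pointerChasing m n tower≤n =
  protocol , AllCollapsing⇒IsNOF protocol collapsing , correct , collapsing ,
  λ x px → ≤-trans (cost x px) (k[2n+[1+A]n]≤4knA (2 + m) n ℓ₀ 1≤ℓ₀)
  where
  ℓ₀ = iterLog (suc m) n
  1≤ℓ₀ : 1 ≤ ℓ₀
  1≤ℓ₀ = subst (_≤ ℓ₀) (iterLog[tower]≡1 (suc m)) (iterLog-mono-≤ (suc m) tower≤n)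
  instance
    n≢0 : NonZero n
    n≢0 = >-nonZero (≤-trans 1≤ℓ₀ (iterLog≤ (suc m) n))
  open PointerChasing m n

theorem1p5 : ∀ k → 3 ≤ k → ∃ λ C → ∃ λ N → ∀ n → N ≤ n →
    Σ (Protocol k n) λ P → IsNOF P × Correct P × AllCollapsing P
    × CostAtMost P (C * n * iterLog (k ∸ 1) n)
theorem1p5 (suc (suc (suc m))) (s≤s (s≤s (s≤s z≤n))) = 4 * (3 + m) , tower (2 + m) , pointerChasing (suc m)
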